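{- Let $H$ be a bipartite graph with bipartition classes $X$ and $Y$, let $k\geq 1$, and let $A_X=\{u_0,\ldots,u_{2k}\} \subseteq X$ and $A_Y=\{v_0,\ldots,v_{2k}\} \subseteq Y$ be such that $(A_X,A_Y)$ is a special edge asteroid. For each $i \in \{0,\ldots,2k\}$ (indices modulo $2k+1$), let the $u_i$-$u_{i+1}$-path $\mathcal{W}_{i,i+1}$ be chosen as follows: among all $u_i$-$u_{i+1}$-paths satisfying the conditions (a) and (b) of the definition of a special edge asteroid, take only shortest ones; among these, if possible, restrict to paths containing $v_i$; among the paths still in consideration, select one containing $v_{i+1}$, if possible. Then for each $i \in \{0, \ldots, 2k\}$ there exists an induced $v_i$-$v_{i+1}$-path $\mathcal{W}'_{i,i+1}$, such that (a) there are no edges between $\{u_i,v_i\}$ and $\{u_{i+k},u_{i+k+1}\}\cup \mathcal{W}'_{i+k,i+k+1}$, (b) there are no edges between $\{u_0,v_0\}$ and $\{u_1,\ldots,u_{2k}\} \cup \bigcup_{i=1}^{2k-1} \mathcal{W}'_{i,i+1}$. Furthermore $A_X \cup A_Y \cup \bigcup_{i=0}^{2k} \mathcal{W}_{i,i+1} = A_X \cup A_Y \cup \bigcup_{i=0}^{2k} \mathcal{W}'_{i,i+1}$.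
   Context: A pair $(A_X,A_Y)$ with $A_X=\{u_0,\ldots,u_{2k}\} \subseteq X$, $A_Y=\{v_0,\ldots,v_{2k}\} \subseteq Y$ ($k\geq1$) is a special edge asteroid if for each $i \in \{0,\ldots,2k\}$ the vertices $u_i$ and $v_i$ are adjacent and there exists a $u_i$-$u_{i+1}$-path $\mathcal{W}_{i,i+1}$ (indices modulo $2k+1$) such that (a) there are no edges between $\{u_i,v_i\}$ and $\{v_{i+k},v_{i+k+1}\}\cup \mathcal{W}_{i+k,i+k+1}$, and (b) there are no edges between $\{u_0,v_0\}$ and $\{v_1,\ldots,v_{2k}\} \cup \bigcup_{i=1}^{2k-1} \mathcal{W}_{i,i+1}$. -}

module Defs where

open import Data.Nat using (ℕ; zero; suc; _+_; _*_; _≤_; _<_)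
open import Data.Nat.DivMod using (_mod_)
open import Data.Fin using (Fin; toℕ; fromℕ<)
import Data.Fin as F
open import Data.Bool using (Bool; true; false)
open import Data.List using (List; []; _∷_; head; last; length; lookup)
open import Data.List.Membership.Propositional using (_∈_)
open import Data.List.Relation.Unary.Linked using (Linked)
open import Data.List.Relation.Unary.Unique.Propositional using (Unique)
open import Data.Maybe using (just)
open import Data.Product using (Σ; ∃; _×_)
open import Data.Sum using (_⊎_)
open import Relation.Binary.Core using (Rel)
open import Relation.Binary.Definitions using (Decidable; Symmetric)
open import Relation.Binary.PropositionalEquality using (_≡_; _≢_)
open import Relation.Nullary using (¬_)
open import Level using (0ℓ)

record BipartiteGraph : Set₁ where
  field
    n      : ℕ
    Adj    : Rel (Fin n) 0ℓ
    adj?   : Decidable Adj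
    sym    : Symmetric Adj
    irrefl : ∀ {x} → ¬ Adj x x
    col    : Fin n → Bool
    bip    : ∀ {x y} → Adj x y → col x ≢ col y

  Vertex : Set
  Vertex = Fin n

  X : Vertex → Set
  X x = col x ≡ false

  Y : Vertex → Set
  Y y = col y ≡ true

open BipartiteGraph public

module _ (G : BipartiteGraph) where

  NoEdges : List (Vertex G) → List (Vertex G) → Set
  NoEdges S T = ∀ {s t} → s ∈ S → t ∈ T → ¬ Adj G s t

  IsPath : Vertex G → Vertex G → List (Vertex G) → Set
  IsPath a b P = head P ≡ just a × last P ≡ just b × Linked (Adj G) P × Unique P

  IsInducedPath : Vertex G → Vertex G → List (Vertex G) → Set
  IsInducedPath a b P = IsPath a b P ×
    (∀ (i j : Fin (length P)) → Adj G (lookup P i) (lookup P j) →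
       toℕ j ≡ suc (toℕ i) ⊎ toℕ i ≡ suc (toℕ j))

_⊕_ : ∀ {m} → Fin (suc m) → ℕ → Fin (suc m)
_⊕_ {m} i j = (toℕ i + j) mod (suc m)

module _ (G : BipartiteGraph) (k : ℕ)
         (u v : Fin (suc (2 * k)) → Vertex G) where

  SpecialEdgeAsteroid : Set
  SpecialEdgeAsteroid =
    (∀ i → X G (u i)) × (∀ i → Y G (v i)) ×
    (∀ i → Adj G (u i) (v i)) ×
    Σ (Fin (suc (2 * k)) → List (Vertex G)) λ W →
      (∀ i → IsPath G (u i) (u (i ⊕ 1)) (W i)) ×
      (∀ i → NoEdges G (u i ∷ v i ∷ [])
                       (v (i ⊕ k) ∷ v (i ⊕ (k + 1)) ∷ W (i ⊕ k))) ×
      (∀ j → 1 ≤ toℕ j → NoEdges G (u F.zero ∷ v F.zero ∷ []) (v j ∷ [])) ×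
      (∀ j → 1 ≤ toℕ j → toℕ j < 2 * k →
             NoEdges G (u F.zero ∷ v F.zero ∷ []) (W j))

  -- P is a u_i-u_{i+1}-path satisfying the (path-dependent parts of the)
  -- conditions (a) and (b) as the path W_{i,i+1}
  Admissible : Fin (suc (2 * k)) → List (Vertex G) → Set
  Admissible i P =
    IsPath G (u i) (u (i ⊕ 1)) P ×
    (∀ j → j ⊕ k ≡ i → NoEdges G (u j ∷ v j ∷ []) P) ×
    (1 ≤ toℕ i → toℕ i < 2 * k → NoEdges G (u F.zero ∷ v F.zero ∷ []) P)

  -- W is chosen as in the statement: admissible; shortest among admissible;
  -- among those, contains v_i if possible; among the remaining, contains
  -- v_{i+1} if possible.
  Chosen : Fin (suc (2 * k)) → List (Vertex G) → Set
  Chosen i W =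
    Admissible i W ×
    (∀ P → Admissible i P →
       length W ≤ length P ×
       (length P ≡ length W → v i ∈ P → v i ∈ W) ×
       (length P ≡ length W → (v i ∈ P → v i ∈ W) → (v i ∈ W → v i ∈ P) →
          v (i ⊕ 1) ∈ P → v (i ⊕ 1) ∈ W))

  InUnion : (Fin (suc (2 * k)) → List (Vertex G)) → Vertex G → Set
  InUnion W x = (∃ λ i → x ≡ u i) ⊎ (∃ λ i → x ≡ v i) ⊎ (∃ λ i → x ∈ W i)

-- Write W for W_{i,i+1}, let s be the last vertex of W adjacent to v_i and t the first vertex
-- from s on adjacent to v_{i+1}, and let W′ be v_i, then W from s to t, then v_{i+1}. A chord of
-- W would shortcut it to a shorter admissible path, so W is chordless and W′ is induced. The part
-- of W before s lies in {u_i, v_i}: replacing it by u_i v_i gives an admissible path, so it has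
-- at most two vertices, and if it has two, the tie and the preference for v_i force the second
-- one to be v_i. Symmetrically the part after t lies in {v_{i+1}, u_{i+1}}, now by the preference
-- for v_{i+1}. So W and W′ differ only in vertices of A_X ∪ A_Y, and (a) and (b) for W′ follow
-- from (a) and (b) for W and for the asteroid.

module Submission where

open import Defs renaming (sym to Adj-sym)
open import Data.Nat using (ℕ; suc; _+_; _*_; _≤_; _<_; _%_; s≤s; z≤n; s≤s⁻¹; _<?_)
open import Data.Nat.Properties
  using ( +-assoc; +-comm; ≤-trans; ≤-antisym; ≮⇒≥; <-irrefl; n<1+n; <⇒≢; <⇒≱; +-monoʳ-<
        ; +-cancelˡ-≤; m≤n*m; *-monoʳ-≤; ≤-reflexive)
open import Data.Nat.DivMod using (%-distribˡ-+; m%n%n≡m%n; m<n⇒m%n≡m; n%n≡0)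
open import Data.Fin using (Fin; toℕ; zero; inject₁) renaming (suc to fsuc)
open import Data.Fin.Properties using (toℕ-fromℕ<; toℕ-injective; toℕ<n; toℕ-inject₁)
open import Data.List using (List; []; _∷_; _++_; _∷ʳ_; head; last; length; lookup; drop)
open import Data.List.Properties using (++-assoc; length-++; length-++-≤ʳ)
open import Data.List.Membership.Propositional using (_∈_; _∉_)
open import Data.List.Membership.Propositional.Properties
  using (∈-++⁺ˡ; ∈-++⁺ʳ; ∈-++⁻; ∈-∃++; ∈-lookup)
open import Data.List.Relation.Unary.Any using (here; there)
open import Data.List.Relation.Unary.All as All using (All; []; _∷_)
import Data.List.Relation.Unary.All.Properties as All
open import Data.List.Relation.Unary.AllPairs using ([]; _∷_)
open import Data.List.Relation.Unary.Linked using (Linked; []; [-]; _∷_; tail)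
open import Data.List.Relation.Unary.Unique.Propositional using (Unique)
import Data.List.Relation.Unary.Unique.Propositional.Properties as Unique
open import Data.List.Relation.Binary.Disjoint.Propositional using (Disjoint)
open import Data.List.Relation.Binary.Subset.Propositional using (_⊆_)
open import Data.List.Relation.Binary.Sublist.Propositional as Sublist
  using ([]; _∷_) renaming (_⊆_ to _⊑_)
open import Data.List.Relation.Binary.Sublist.Propositional.Properties
  using (All-resp-⊆; drop⁺-⊆; ++⁺; ++⁺ˡ; ++⁺ʳ)
open import Data.Maybe using (just)
open import Data.Maybe.Properties using (just-injective)
open import Data.Empty using (⊥-elim)
open import Data.Product using (Σ; ∃-syntax; _×_; _,_; proj₁; proj₂)
open import Data.Sum as Sum using (_⊎_; inj₁; inj₂)
open import Function using (_∘_)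
open import Function.Definitions using (Injective)
open import Function.Bundles using (_⇔_; mk⇔)
open import Level using (Level; _⊔_)
open import Relation.Binary.Core using (Rel)
open import Relation.Binary.Definitions using (Symmetric)
open import Relation.Binary.PropositionalEquality
  using (_≡_; _≢_; refl; sym; trans; cong; subst; subst₂; module ≡-Reasoning)
open import Relation.Nullary using (¬_; yes; no)
open import Relation.Unary using (Pred; Decidable; ∁)

private
  variable
    a ℓ : Level
    A : Set a
    x y z : A
    xs ys zs : List A

last-++-∷ : ∀ xs → last (xs ++ y ∷ ys) ≡ last (y ∷ ys)
last-++-∷ []               = refl
last-++-∷ (_ ∷ [])         = refl
last-++-∷ (_ ∷ x′ ∷ xs)    = last-++-∷ (x′ ∷ xs)

head≡just⇒∈ : head xs ≡ just x → x ∈ xs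
head≡just⇒∈ {xs = _ ∷ _} refl = here refl

last≡just⇒∈ : last xs ≡ just x → x ∈ xs
last≡just⇒∈ {xs = _ ∷ []}     refl = here refl
last≡just⇒∈ {xs = _ ∷ _ ∷ _}  eq   = there (last≡just⇒∈ eq)

last≡just-∷ : ∀ xs → last xs ≡ just x → last (y ∷ xs) ≡ just x
last≡just-∷ (_ ∷ _) eq = eq

head-++-∷ : ∀ xs → head (xs ++ x ∷ ys) ≡ head (xs ++ x ∷ zs)
head-++-∷ []      = refl
head-++-∷ (_ ∷ _) = refl

∈-++-∷-∉ʳ : ∀ xs → z ∉ ys → z ∈ xs ++ y ∷ ys → z ∈ xs ++ y ∷ zs
∈-++-∷-∉ʳ []       z∉ys (here z≡y)    = here z≡y
∈-++-∷-∉ʳ []       z∉ys (there z∈ys)  = ⊥-elim (z∉ys z∈ys)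
∈-++-∷-∉ʳ (_ ∷ _)  z∉ys (here z≡x)    = here z≡x
∈-++-∷-∉ʳ (_ ∷ xs) z∉ys (there z∈)    = there (∈-++-∷-∉ʳ xs z∉ys z∈)

All-++-∷∷ : ∀ {P : Pred A ℓ} xs → All P (xs ∷ʳ y) → P z → All P (xs ++ y ∷ z ∷ [])
All-++-∷∷ []       (py ∷ []) pz = py ∷ pz ∷ []
All-++-∷∷ (_ ∷ xs) (px ∷ ps) pz = px ∷ All-++-∷∷ xs ps pz

module _ {Q : Pred A ℓ} (Q? : Decidable Q) where

  split-at-first : ∀ xs →
    (∃[ ys ] ∃[ y ] ∃[ zs ] xs ≡ ys ++ y ∷ zs × All (∁ Q) ys × Q y) ⊎ All (∁ Q) xs
  split-at-first []       = inj₂ []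
  split-at-first (x ∷ xs) with Q? x | split-at-first xs
  ... | yes qx | _ = inj₁ ([] , x , xs , refl , [] , qx)
  ... | no ¬qx | inj₁ (ys , y , zs , refl , ¬qys , qy) = inj₁ (x ∷ ys , y , zs , refl , ¬qx ∷ ¬qys , qy)
  ... | no ¬qx | inj₂ ¬qxs = inj₂ (¬qx ∷ ¬qxs)

  split-at-last : ∀ xs →
    (∃[ ys ] ∃[ y ] ∃[ zs ] xs ≡ ys ++ y ∷ zs × Q y × All (∁ Q) zs) ⊎ All (∁ Q) xs
  split-at-last []       = inj₂ []
  split-at-last (x ∷ xs) with split-at-last xs | Q? x
  ... | inj₁ (ys , y , zs , refl , qy , ¬qzs) | _ = inj₁ (x ∷ ys , y , zs , refl , qy , ¬qzs)
  ... | inj₂ ¬qxs | yes qx = inj₁ ([] , x , xs , refl , qx , ¬qxs)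
  ... | inj₂ ¬qxs | no ¬qx = inj₂ (¬qx ∷ ¬qxs)

Unique-∷⁺ : x ∉ xs → Unique xs → Unique (x ∷ xs)
Unique-∷⁺ x∉xs u = All.¬Any⇒All¬ _ x∉xs ∷ u

Unique-resp-⊒ : xs ⊑ ys → Unique ys → Unique xs
Unique-resp-⊒ []          u        = u
Unique-resp-⊒ (_ Sublist.∷ʳ τ) (_ ∷ u)  = Unique-resp-⊒ τ u
Unique-resp-⊒ (refl ∷ τ)  (px ∷ u) = All-resp-⊆ τ px ∷ Unique-resp-⊒ τ u

Unique-++⁻ʳ : ∀ xs → Unique (xs ++ ys) → Unique ys
Unique-++⁻ʳ xs = Unique-resp-⊒ (++⁺ˡ xs Sublist.⊆-refl)

Unique-++⇒Disjoint : ∀ xs → Unique (xs ++ ys) → Disjoint xs ys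
Unique-++⇒Disjoint (_ ∷ xs) (px ∷ _) (here refl , y∈ys) = All.lookup px (∈-++⁺ʳ xs y∈ys) refl
Unique-++⇒Disjoint (_ ∷ xs) (_ ∷ u)  (there x∈xs , y∈ys) = Unique-++⇒Disjoint xs u (x∈xs , y∈ys)

Unique-++-∷ : ∀ xs → Unique (xs ++ y ∷ ys) → Unique (y ∷ zs) → Disjoint xs zs →
              Unique (xs ++ y ∷ zs)
Unique-++-∷ xs u u′ disj = Unique.++⁺ (Unique-resp-⊒ (++⁺ʳ _ Sublist.⊆-refl) u) u′ disj′
  where
  disj′ : Disjoint xs (_ ∷ _)
  disj′ (x∈xs , here refl) = Unique-++⇒Disjoint xs u (x∈xs , here refl)
  disj′ (x∈xs , there x∈zs) = disj (x∈xs , x∈zs)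

module _ {A : Set a} {R : Rel A ℓ} where

  Linked-++⁻ʳ : ∀ xs → Linked R (xs ++ ys) → Linked R ys
  Linked-++⁻ʳ []           l       = l
  Linked-++⁻ʳ (_ ∷ [])     [-]     = []
  Linked-++⁻ʳ (_ ∷ [])     (_ ∷ l) = l
  Linked-++⁻ʳ (_ ∷ x ∷ xs) (_ ∷ l) = Linked-++⁻ʳ (x ∷ xs) l

  Linked-++⁻ˡ : ∀ xs → Linked R (xs ++ ys) → Linked R xs
  Linked-++⁻ˡ []           _       = []
  Linked-++⁻ˡ (_ ∷ [])     _       = [-]
  Linked-++⁻ˡ (_ ∷ x ∷ xs) (r ∷ l) = r ∷ Linked-++⁻ˡ (x ∷ xs) l

  Linked-++-∷⁻ : ∀ xs → Linked R (xs ++ y ∷ ys) → Linked R (xs ∷ʳ y)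
  Linked-++-∷⁻ []           _       = [-]
  Linked-++-∷⁻ (_ ∷ [])     (r ∷ _) = r ∷ [-]
  Linked-++-∷⁻ (_ ∷ x ∷ xs) (r ∷ l) = r ∷ Linked-++-∷⁻ (x ∷ xs) l

  Linked-++-∷⁺ : ∀ xs → Linked R (xs ∷ʳ y) → Linked R (y ∷ ys) → Linked R (xs ++ y ∷ ys)
  Linked-++-∷⁺ []           _       l = l
  Linked-++-∷⁺ (_ ∷ [])     (r ∷ _) l = r ∷ l
  Linked-++-∷⁺ (_ ∷ x ∷ xs) (r ∷ l) l′ = r ∷ Linked-++-∷⁺ (x ∷ xs) l l′

  no-predecessor⇒head : Linked R xs → All (λ z → ¬ R z y) xs → y ∈ xs → head xs ≡ just y
  no-predecessor⇒head _        _            (here refl) = refl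
  no-predecessor⇒head (r ∷ l) (¬r ∷ ¬rs) (there y∈xs) with no-predecessor⇒head l ¬rs y∈xs
  ... | refl = ⊥-elim (¬r r)

  no-successor⇒last : Linked R xs → All (λ z → ¬ R y z) xs → y ∈ xs → last xs ≡ just y
  no-successor⇒last [-]      _             (here refl)  = refl
  no-successor⇒last (r ∷ _) (_ ∷ ¬r ∷ _)  (here refl)  = ⊥-elim (¬r r)
  no-successor⇒last (_ ∷ l) (_ ∷ ¬rs)     (there y∈xs) = no-successor⇒last l ¬rs y∈xs

module _ {A : Set a} (R : Rel A ℓ) where

  data Chordless : List A → Set (a ⊔ ℓ) where
    []  : Chordless []
    _∷_ : All (λ z → ¬ R x z) (drop 1 xs) → Chordless xs → Chordless (x ∷ xs)

module _ {A : Set a} {R : Rel A ℓ} where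

  Chordless-resp-⊒ : xs ⊑ ys → Chordless R ys → Chordless R xs
  Chordless-resp-⊒ []            c       = c
  Chordless-resp-⊒ (_ Sublist.∷ʳ τ) (_ ∷ c) = Chordless-resp-⊒ τ c
  Chordless-resp-⊒ (refl ∷ τ)    (n ∷ c) = All-resp-⊆ (drop⁺-⊆ 1 τ) n ∷ Chordless-resp-⊒ τ c

  Chordless-++-∷∷ : ∀ xs → Chordless R (xs ∷ʳ y) → All (λ x → ¬ R x z) xs →
                    Chordless R (xs ++ y ∷ z ∷ [])
  Chordless-++-∷∷ []            ([] ∷ [])  []          = [] ∷ [] ∷ []
  Chordless-++-∷∷ (_ ∷ [])      (_ ∷ c)    (¬r ∷ [])   = (¬r ∷ []) ∷ Chordless-++-∷∷ [] c []
  Chordless-++-∷∷ (_ ∷ x ∷ xs)  (n ∷ c)    (¬r ∷ ¬rs)  =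
    All-++-∷∷ xs n ¬r ∷ Chordless-++-∷∷ (x ∷ xs) c ¬rs

  Chordless-intro : (∀ ys x zs → xs ≡ ys ++ x ∷ zs → All (λ z → ¬ R x z) (drop 1 zs)) →
                    Chordless R xs
  Chordless-intro {xs = []}     _     = []
  Chordless-intro {xs = x ∷ xs} split =
    split [] x xs refl ∷ Chordless-intro (λ ys y zs eq → split (x ∷ ys) y zs (cong (x ∷_) eq))

  private
    Chordless-head : (∀ {x} → ¬ R x x) → All (λ z → ¬ R x z) (drop 1 xs) →
                     ∀ j → R x (lookup (x ∷ xs) j) → toℕ j ≡ 1
    Chordless-head irr _ zero r = ⊥-elim (irr r)
    Chordless-head {xs = _ ∷ _}  irr _ (fsuc zero)     _ = refl
    Chordless-head {xs = _ ∷ xs} irr n (fsuc (fsuc j)) r = ⊥-elim (All.lookup n (∈-lookup j) r)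

  Chordless⇒adjacent-indices : Symmetric R → (∀ {x} → ¬ R x x) → Chordless R xs →
    ∀ i j → R (lookup xs i) (lookup xs j) → toℕ j ≡ suc (toℕ i) ⊎ toℕ i ≡ suc (toℕ j)
  Chordless⇒adjacent-indices {xs = _ ∷ xs} _ irr (n ∷ _) zero j r =
    inj₁ (Chordless-head {xs = xs} irr n j r)
  Chordless⇒adjacent-indices {xs = _ ∷ xs} R-sym irr (n ∷ _) (fsuc i) zero r =
    inj₂ (Chordless-head {xs = xs} irr n (fsuc i) (R-sym r))
  Chordless⇒adjacent-indices R-sym irr (_ ∷ c) (fsuc i) (fsuc j) r =
    Sum.map (cong suc) (cong suc) (Chordless⇒adjacent-indices R-sym irr c i j r)

module _ {m : ℕ} where

  private
    N : ℕ
    N = suc m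

  toℕ-⊕ : ∀ (i : Fin N) j → toℕ (i ⊕ j) ≡ (toℕ i + j) % N
  toℕ-⊕ i j = toℕ-fromℕ< _

  ⊕-assoc : ∀ (i : Fin N) j l → (i ⊕ j) ⊕ l ≡ i ⊕ (j + l)
  ⊕-assoc i j l = toℕ-injective (begin
    toℕ ((i ⊕ j) ⊕ l)               ≡⟨ toℕ-⊕ (i ⊕ j) l ⟩
    (toℕ (i ⊕ j) + l) % N           ≡⟨ cong (λ z → (z + l) % N) (toℕ-⊕ i j) ⟩
    ((toℕ i + j) % N + l) % N       ≡⟨ %-distribˡ-+ ((toℕ i + j) % N) l N ⟩
    ((toℕ i + j) % N % N + l % N) % N ≡⟨ cong (λ z → (z + l % N) % N) (m%n%n≡m%n (toℕ i + j) N) ⟩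
    ((toℕ i + j) % N + l % N) % N   ≡⟨ %-distribˡ-+ (toℕ i + j) l N ⟨
    (toℕ i + j + l) % N             ≡⟨ cong (_% N) (+-assoc (toℕ i) j l) ⟩
    (toℕ i + (j + l)) % N           ≡⟨ toℕ-⊕ i (j + l) ⟨
    toℕ (i ⊕ (j + l))               ∎)
    where open ≡-Reasoning

  toℕ-⊕1 : ∀ (i : Fin N) → toℕ i < m → toℕ (i ⊕ 1) ≡ suc (toℕ i)
  toℕ-⊕1 i i<m = begin
    toℕ (i ⊕ 1)       ≡⟨ toℕ-⊕ i 1 ⟩
    (toℕ i + 1) % N   ≡⟨ cong (_% N) (+-comm (toℕ i) 1) ⟩
    suc (toℕ i) % N   ≡⟨ m<n⇒m%n≡m (s≤s i<m) ⟩
    suc (toℕ i)       ∎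
    where open ≡-Reasoning

  toℕ-⊕1-last : ∀ (i : Fin N) → toℕ i ≡ m → toℕ (i ⊕ 1) ≡ 0
  toℕ-⊕1-last i i≡m = begin
    toℕ (i ⊕ 1)          ≡⟨ toℕ-⊕ i 1 ⟩
    (toℕ i + 1) % N      ≡⟨ cong (λ z → (z + 1) % N) i≡m ⟩
    (m + 1) % N          ≡⟨ cong (_% N) (+-comm m 1) ⟩
    N % N                ≡⟨ n%n≡0 N ⟩
    0                    ∎
    where open ≡-Reasoning

  ⊕1-≢ : 1 ≤ m → ∀ (i : Fin N) → i ≢ i ⊕ 1
  ⊕1-≢ 1≤m i i≡i⊕1 with toℕ i <? m
  ... | yes i<m = <-irrefl (trans (cong toℕ i≡i⊕1) (toℕ-⊕1 i i<m)) (n<1+n (toℕ i))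
  ... | no  i≮m = <⇒≢ 1≤m (trans (sym (toℕ-⊕1-last i i≡m)) (trans (cong toℕ (sym i≡i⊕1)) i≡m))
    where
    i≡m : toℕ i ≡ m
    i≡m = ≤-antisym (s≤s⁻¹ (toℕ<n i)) (≮⇒≥ i≮m)

  ⊕1-predecessor : ∀ (j : Fin N) → 1 ≤ toℕ j → ∃[ i ] i ⊕ 1 ≡ j × suc (toℕ i) ≡ toℕ j
  ⊕1-predecessor (fsuc j) _ =
    inject₁ j , toℕ-injective (trans (toℕ-⊕1 (inject₁ j) i<m) i+1≡j) , i+1≡j
    where
    i+1≡j : suc (toℕ (inject₁ j)) ≡ suc (toℕ j)
    i+1≡j = cong suc (toℕ-inject₁ j)
    i<m : toℕ (inject₁ j) < m
    i<m = subst (_< m) (sym (toℕ-inject₁ j)) (toℕ<n j)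

module _ (G : BipartiteGraph) {x y : Vertex G} where

  X-Y-distinct : X G x → Y G y → x ≢ y
  X-Y-distinct x∈X y∈Y refl with trans (sym x∈X) y∈Y
  ... | ()

  Y-independent : Y G x → Y G y → ¬ Adj G x y
  Y-independent x∈Y y∈Y x∼y = bip G x∼y (trans x∈Y (sym y∈Y))

module _ (G : BipartiteGraph) where

  IsInducedPath-++-∷∷ : ∀ {x} xs {y zs z} →
    Linked (Adj G) (x ∷ xs ++ y ∷ zs) → Unique (x ∷ xs ++ y ∷ zs) →
    Chordless (Adj G) (x ∷ xs ++ y ∷ zs) → Adj G y z → All (λ w → ¬ Adj G w z) (x ∷ xs) →
    z ∉ x ∷ xs → IsInducedPath G x z (x ∷ xs ++ y ∷ z ∷ [])
  IsInducedPath-++-∷∷ {x} xs {y} {zs} {z} linked unique chordless y∼z ¬∼z z∉ =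
    (refl , last-++-∷ (x ∷ xs) ,
     Linked-++-∷⁺ (x ∷ xs) (Linked-++-∷⁻ (x ∷ xs) linked) (y∼z ∷ [-]) ,
     Unique-++-∷ (x ∷ xs) unique (Unique-∷⁺ y∉z ([] ∷ [])) λ { (z∈ , here refl) → z∉ z∈ }) ,
    Chordless⇒adjacent-indices (Adj-sym G) (irrefl G)
      (Chordless-++-∷∷ (x ∷ xs) (Chordless-resp-⊒ prefix chordless) ¬∼z)
    where
    prefix : (x ∷ xs) ∷ʳ y ⊑ x ∷ xs ++ y ∷ zs
    prefix = refl ∷ ++⁺ Sublist.⊆-refl (refl ∷ Sublist.minimum zs)
    y∉z : y ∉ z ∷ []
    y∉z (here refl) = irrefl G y∼z

module ShortestPaths (G : BipartiteGraph) (Good : Vertex G → Set) (a b : Vertex G) where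

  GoodPath : List (Vertex G) → Set
  GoodPath P = IsPath G a b P × (∀ {x} → x ∈ P → Good x)

  Shortest : List (Vertex G) → Set
  Shortest W = GoodPath W × (∀ {Q} → GoodPath Q → length W ≤ length Q)

  chord-shortcut : ∀ ys {x y} zs {z ws} → GoodPath (ys ++ x ∷ y ∷ zs ++ z ∷ ws) → Adj G x z →
                   GoodPath (ys ++ x ∷ z ∷ ws)
  chord-shortcut ys {x} {y} zs {z} {ws} ((head≡a , last≡b , linked , unique) , good) x∼z =
    (trans (head-++-∷ ys) head≡a , trans last≡ last≡b , linked′ , Unique-resp-⊒ sub unique) ,
    good ∘ Sublist.lookup sub
    where
    sub : ys ++ x ∷ z ∷ ws ⊑ ys ++ x ∷ y ∷ zs ++ z ∷ ws
    sub = ++⁺ Sublist.⊆-refl (refl ∷ (y Sublist.∷ʳ ++⁺ˡ zs Sublist.⊆-refl))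
    last≡ : last (ys ++ x ∷ z ∷ ws) ≡ last (ys ++ x ∷ y ∷ zs ++ z ∷ ws)
    last≡ = begin
      last (ys ++ x ∷ z ∷ ws)             ≡⟨ last-++-∷ ys ⟩
      last (z ∷ ws)                       ≡⟨ last-++-∷ (x ∷ y ∷ zs) ⟨
      last (x ∷ y ∷ zs ++ z ∷ ws)         ≡⟨ last-++-∷ ys ⟨
      last (ys ++ x ∷ y ∷ zs ++ z ∷ ws)   ∎
      where open ≡-Reasoning
    linked′ : Linked (Adj G) (ys ++ x ∷ z ∷ ws)
    linked′ = Linked-++-∷⁺ ys (Linked-++-∷⁻ ys linked)
                (x∼z ∷ Linked-++⁻ʳ (x ∷ y ∷ zs) (Linked-++⁻ʳ ys linked))

  chord-shortens : ∀ (ys : List (Vertex G)) {x y} zs {z ws} →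
                   length (ys ++ x ∷ z ∷ ws) < length (ys ++ x ∷ y ∷ zs ++ z ∷ ws)
  chord-shortens ys zs {z} {ws} = subst₂ _<_ (sym (length-++ ys)) (sym (length-++ ys))
    (+-monoʳ-< (length ys) (s≤s (s≤s (length-++-≤ʳ (z ∷ ws) {zs}))))

  Shortest⇒no-chord : ∀ ys {x y} zs {z} → Shortest (ys ++ x ∷ y ∷ zs) → z ∈ zs → ¬ Adj G x z
  Shortest⇒no-chord ys {x} {y} zs {z} (good-path , minimal) z∈zs x∼z with ∈-∃++ z∈zs
  ... | zs₁ , ws , refl =
    <⇒≱ (chord-shortens ys {x} {y} zs₁ {z} {ws}) (minimal (chord-shortcut ys zs₁ good-path x∼z))

  Shortest⇒Chordless : ∀ {W} → Shortest W → Chordless (Adj G) W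
  Shortest⇒Chordless shortest = Chordless-intro (no-chord shortest)
    where
    no-chord : ∀ {W} → Shortest W → ∀ ys x zs → W ≡ ys ++ x ∷ zs →
               All (λ z → ¬ Adj G x z) (drop 1 zs)
    no-chord _        _  _ []       _    = []
    no-chord shortest ys _ (_ ∷ zs) refl = All.tabulate (Shortest⇒no-chord ys zs shortest)

module Preference (G : BipartiteGraph) (Good : Vertex G → Set) {a b a′ b′ : Vertex G}
  (a∈X : X G a) (b∈X : X G b) (a′∈Y : Y G a′) (b′∈Y : Y G b′)
  (a∼a′ : Adj G a a′) (b∼b′ : Adj G b b′) (a′≢b′ : a′ ≢ b′)
  (good-a′ : Good a′) (good-b′ : Good b′) where

  open ShortestPaths G Good a b

  private
    V : Set
    V = Vertex G

    _∼_ : V → V → Set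
    _∼_ = Adj G

  record Preferred (W : List V) : Set where
    field
      shortest   : Shortest W
      prefers-a′ : ∀ {Q} → GoodPath Q → length Q ≡ length W → a′ ∈ Q → a′ ∈ W
      prefers-b′ : ∀ {Q} → GoodPath Q → length Q ≡ length W →
                   (a′ ∈ Q → a′ ∈ W) → (a′ ∈ W → a′ ∈ Q) → b′ ∈ Q → b′ ∈ W

  a′∉-after-last-neighbour : ∀ {M} → Linked _∼_ (a′ ∷ M) → All (λ z → ¬ a′ ∼ z) (drop 1 M) →
                             last M ≡ just b → a′ ∉ M
  a′∉-after-last-neighbour (a′∼m ∷ _) _ _ (here refl) = irrefl G a′∼m
  a′∉-after-last-neighbour {_ ∷ M} (_ ∷ linked) ¬a′∼M last≡b (there a′∈M) =
    X-Y-distinct G b∈X a′∈Y (just-injective (trans (sym last≡b)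
      (last≡just-∷ M (no-successor⇒last (tail linked) ¬a′∼M a′∈M))))

  b′∉-before-first-neighbour : ∀ P {M} → Linked _∼_ (a′ ∷ P ++ M) → All (λ z → ¬ b′ ∼ z) P →
                               b′ ∉ P
  b′∉-before-first-neighbour P linked ¬b′∼P b′∈P =
    a′≢b′ (just-injective (no-predecessor⇒head (Linked-++⁻ˡ (a′ ∷ P) linked)
      (Y-independent G a′∈Y b′∈Y ∷ All.map (_∘ Adj-sym G) ¬b′∼P) (there b′∈P)))

  private
    prefix-⊆′ : ∀ D {M} → Preferred (a ∷ D ++ M) → GoodPath (a ∷ a′ ∷ M) → a′ ∉ M →
                a ∷ D ⊆ a ∷ a′ ∷ []
    prefix-⊆′ []            _    _ _    (here refl) = here refl
    prefix-⊆′ (_ ∷ [])      _    _ _    (here refl) = here refl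
    prefix-⊆′ (_ ∷ [])      pref Q a′∉M (there (here refl))
      with Preferred.prefers-a′ pref Q refl (there (here refl))
    ... | here a′≡a          = ⊥-elim (X-Y-distinct G a∈X a′∈Y (sym a′≡a))
    ... | there (here a′≡d)  = there (here (sym a′≡d))
    ... | there (there a′∈M) = ⊥-elim (a′∉M a′∈M)
    prefix-⊆′ (_ ∷ _ ∷ D) {M} pref Q _ _ =
      ⊥-elim (<⇒≱ (s≤s⁻¹ (s≤s⁻¹ (proj₂ (Preferred.shortest pref) Q))) (length-++-≤ʳ M {D}))

  prefix-⊆ : ∀ D {M} → Preferred (D ++ M) → Linked _∼_ (a′ ∷ M) → a′ ∉ M → last M ≡ just b →
             D ⊆ a ∷ a′ ∷ []
  prefix-⊆ []      _    _      _    _      ()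
  prefix-⊆ (d ∷ D) {M} pref linked a′∉M last≡b with Preferred.shortest pref
  ... | ((refl , _ , _ , unique) , good) , _ = prefix-⊆′ D pref Q a′∉M
    where
    a∉a′∷M : a ∉ a′ ∷ M
    a∉a′∷M (here a≡a′)  = X-Y-distinct G a∈X a′∈Y a≡a′
    a∉a′∷M (there a∈M)  = Unique-++⇒Disjoint (a ∷ D) unique (here refl , a∈M)
    good-Q : ∀ {x} → x ∈ a ∷ a′ ∷ M → Good x
    good-Q (here refl)         = good (here refl)
    good-Q (there (here refl)) = good-a′
    good-Q (there (there x∈M)) = good (∈-++⁺ʳ (a ∷ D) x∈M)
    Q : GoodPath (a ∷ a′ ∷ M)
    Q = (refl , last≡just-∷ M last≡b , a∼a′ ∷ linked ,
         Unique-∷⁺ a∉a′∷M (Unique-∷⁺ a′∉M (Unique-++⁻ʳ (a ∷ D) unique))) ,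
        good-Q

  private
    suffix-⊆′ : ∀ A t e E → Preferred (A ++ t ∷ e ∷ E) → GoodPath (A ++ t ∷ b′ ∷ b ∷ []) →
                b′ ∼ t → b′ ∉ A → a′ ∉ e ∷ E → e ∷ E ⊆ b ∷ b′ ∷ []
    suffix-⊆′ A t e [] pref _ _ _ _ (here refl) with Preferred.shortest pref
    ... | ((_ , last≡b , _) , _) , _ = here (just-injective (trans (sym (last-++-∷ A)) last≡b))
    suffix-⊆′ A t e (e₂ ∷ []) pref Q b′∼t b′∉A a′∉E x∈ with Preferred.shortest pref
    ... | ((_ , last≡b , _) , _) , _ with just-injective (trans (sym (last-++-∷ A)) last≡b) | x∈
    ...   | refl | there (here refl) = here refl
    ...   | refl | here refl         = there (here (sym (b′≡e (∈-++⁻ A b′∈W))))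
      where
      a′∉b′∷b : a′ ∉ b′ ∷ b ∷ []
      a′∉b′∷b (here a′≡b′)         = a′≢b′ a′≡b′
      a′∉b′∷b (there (here a′≡b))  = X-Y-distinct G b∈X a′∈Y (sym a′≡b)
      b′∈W : b′ ∈ A ++ t ∷ e ∷ b ∷ []
      b′∈W = Preferred.prefers-b′ pref Q (trans (length-++ A) (sym (length-++ A)))
               (∈-++-∷-∉ʳ A a′∉b′∷b) (∈-++-∷-∉ʳ A a′∉E) (∈-++⁺ʳ A (there (here refl)))
      b′≡e : b′ ∈ A ⊎ b′ ∈ t ∷ e ∷ b ∷ [] → b′ ≡ e
      b′≡e (inj₁ b′∈A)                     = ⊥-elim (b′∉A b′∈A)
      b′≡e (inj₂ (here refl))              = ⊥-elim (irrefl G b′∼t)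
      b′≡e (inj₂ (there (here b′≡e)))      = b′≡e
      b′≡e (inj₂ (there (there (here b′≡b)))) = ⊥-elim (X-Y-distinct G b∈X b′∈Y (sym b′≡b))
    suffix-⊆′ A t e (_ ∷ _ ∷ E) pref Q _ _ _ _ =
      ⊥-elim (too-long (proj₂ (Preferred.shortest pref) Q))
      where
      too-long : ¬ length (A ++ t ∷ e ∷ _ ∷ _ ∷ E) ≤ length (A ++ t ∷ b′ ∷ b ∷ [])
      too-long le with +-cancelˡ-≤ (length A) _ _ (subst₂ _≤_ (length-++ A) (length-++ A) le)
      ... | s≤s (s≤s (s≤s ()))

  suffix-⊆ : ∀ A t E → Preferred (A ++ t ∷ E) → b′ ∼ t → b′ ∉ A → a′ ∉ E → E ⊆ b ∷ b′ ∷ []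
  suffix-⊆ A t []      _    _    _    _    ()
  suffix-⊆ A t (e ∷ E) pref b′∼t b′∉A a′∉E with Preferred.shortest pref
  ... | ((head≡a , last≡b , linked , unique) , good) , _ =
    suffix-⊆′ A t e E pref Q b′∼t b′∉A a′∉E
    where
    b∈E : b ∈ e ∷ E
    b∈E = last≡just⇒∈ {xs = e ∷ E} (trans (sym (last-++-∷ A)) last≡b)
    t∉b′∷b : t ∉ b′ ∷ b ∷ []
    t∉b′∷b (here refl)        = irrefl G b′∼t
    t∉b′∷b (there (here refl)) = Unique-++⇒Disjoint (t ∷ []) (Unique-++⁻ʳ A unique)
                                   (here refl , b∈E)
    b′∉b : b′ ∉ b ∷ []
    b′∉b (here b′≡b) = X-Y-distinct G b∈X b′∈Y (sym b′≡b)
    disjoint : Disjoint A (b′ ∷ b ∷ [])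
    disjoint (x∈A , here refl)         = b′∉A x∈A
    disjoint (x∈A , there (here refl)) = Unique-++⇒Disjoint A unique (x∈A , there b∈E)
    good-Q : ∀ {x} → x ∈ A ++ t ∷ b′ ∷ b ∷ [] → Good x
    good-Q x∈ with ∈-++⁻ A x∈
    ... | inj₁ x∈A                     = good (∈-++⁺ˡ x∈A)
    ... | inj₂ (here refl)             = good (∈-++⁺ʳ A (here refl))
    ... | inj₂ (there (here refl))     = good-b′
    ... | inj₂ (there (there (here refl))) = good (∈-++⁺ʳ A (there b∈E))
    Q : GoodPath (A ++ t ∷ b′ ∷ b ∷ [])
    Q = (trans (head-++-∷ A) head≡a , last-++-∷ A ,
         Linked-++-∷⁺ A (Linked-++-∷⁻ A linked) (Adj-sym G b′∼t ∷ Adj-sym G b∼b′ ∷ [-]) ,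
         Unique-++-∷ A unique
           (Unique-∷⁺ t∉b′∷b (Unique-∷⁺ b′∉b ([] ∷ []))) disjoint) ,
        good-Q

  record Shortcut (W : List V) : Set where
    field
      path    : List V
      induced : IsInducedPath G a′ b′ path
      path⊆   : path ⊆ a′ ∷ b′ ∷ W
      ⊆path   : W ⊆ a ∷ a′ ∷ b ∷ b′ ∷ path

  private
    shortcut : ∀ D P t E → Preferred (D ++ P ++ t ∷ E) →
               Linked _∼_ (a′ ∷ P ++ t ∷ E) → All (λ z → ¬ a′ ∼ z) (drop 1 (P ++ t ∷ E)) →
               b′ ∼ t → All (λ z → ¬ b′ ∼ z) P → Shortcut (D ++ P ++ t ∷ E)
    shortcut D P t E pref a′-linked ¬a′∼M b′∼t ¬b′∼P with Preferred.shortest pref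
    ... | shortest@(((_ , last≡b , _ , unique) , _) , _) = record
      { path    = W′
      ; induced = IsInducedPath-++-∷∷ G P a′-linked (Unique-∷⁺ a′∉M (Unique-++⁻ʳ D unique))
                    (¬a′∼M ∷ Chordless-resp-⊒ (++⁺ˡ D Sublist.⊆-refl) (Shortest⇒Chordless shortest))
                    (Adj-sym G b′∼t) (Y-independent G a′∈Y b′∈Y ∷ All.map (_∘ Adj-sym G) ¬b′∼P)
                    λ { (here b′≡a′) → a′≢b′ (sym b′≡a′) ; (there b′∈P) → b′∉P b′∈P }
      ; path⊆   = W′⊆
      ; ⊆path   = ⊆W′
      }
      where
      M : List V
      M = P ++ t ∷ E

      W′ : List V
      W′ = a′ ∷ P ++ t ∷ b′ ∷ []

      last-M : last M ≡ just b
      last-M = begin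
        last M                    ≡⟨ last-++-∷ P ⟩
        last (t ∷ E)              ≡⟨ last-++-∷ (D ++ P) ⟨
        last ((D ++ P) ++ t ∷ E)  ≡⟨ cong last (++-assoc D P (t ∷ E)) ⟩
        last (D ++ M)             ≡⟨ last≡b ⟩
        just b                    ∎
        where open ≡-Reasoning

      a′∉M : a′ ∉ M
      a′∉M = a′∉-after-last-neighbour a′-linked ¬a′∼M last-M

      D⊆ : D ⊆ a ∷ a′ ∷ []
      D⊆ = prefix-⊆ D pref a′-linked a′∉M last-M

      b′∉P : b′ ∉ P
      b′∉P = b′∉-before-first-neighbour P a′-linked ¬b′∼P

      b′∉D++P : b′ ∉ D ++ P
      b′∉D++P b′∈ with ∈-++⁻ D b′∈
      ... | inj₂ b′∈P = b′∉P b′∈P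
      ... | inj₁ b′∈D with D⊆ b′∈D
      ...   | here b′≡a         = X-Y-distinct G a∈X b′∈Y (sym b′≡a)
      ...   | there (here b′≡a′) = a′≢b′ (sym b′≡a′)

      E⊆ : E ⊆ b ∷ b′ ∷ []
      E⊆ = suffix-⊆ (D ++ P) t E (subst Preferred (sym (++-assoc D P (t ∷ E))) pref)
             b′∼t b′∉D++P (a′∉M ∘ ∈-++⁺ʳ P ∘ there)

      W′⊆ : W′ ⊆ a′ ∷ b′ ∷ D ++ M
      W′⊆ (here refl) = here refl
      W′⊆ (there x∈) with ∈-++⁻ P x∈
      ... | inj₁ x∈P               = there (there (∈-++⁺ʳ D (∈-++⁺ˡ x∈P)))
      ... | inj₂ (here refl)       = there (there (∈-++⁺ʳ D (∈-++⁺ʳ P (here refl))))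
      ... | inj₂ (there (here refl)) = there (here refl)

      ⊆W′ : D ++ M ⊆ a ∷ a′ ∷ b ∷ b′ ∷ W′
      ⊆W′ x∈ with ∈-++⁻ D x∈
      ... | inj₁ x∈D = ∈-++⁺ˡ (D⊆ x∈D)
      ... | inj₂ x∈M with ∈-++⁻ P x∈M
      ...   | inj₁ x∈P         = there (there (there (there (there (∈-++⁺ˡ x∈P)))))
      ...   | inj₂ (here refl) = there (there (there (there (there (∈-++⁺ʳ P (here refl))))))
      ...   | inj₂ (there x∈E) = there (there (∈-++⁺ˡ (E⊆ x∈E)))

  preferred⇒shortcut : ∀ {W} → Preferred W → Shortcut W
  preferred⇒shortcut {W} pref with Preferred.shortest pref | split-at-last (adj? G a′) W
  ... | ((head≡a , _) , _) , _ | inj₂ ¬a′∼W =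
    ⊥-elim (All.lookup ¬a′∼W (head≡just⇒∈ head≡a) (Adj-sym G a∼a′))
  ... | ((_ , last≡b , linked , _) , _) , _ | inj₁ (D , s , S′ , refl , a′∼s , ¬a′∼S′)
    with split-at-first (adj? G b′) (s ∷ S′)
  ...   | inj₂ ¬b′∼M = ⊥-elim (All.lookup ¬b′∼M
            (last≡just⇒∈ {xs = s ∷ S′} (trans (sym (last-++-∷ D)) last≡b)) (Adj-sym G b∼b′))
  ...   | inj₁ (P , t , E , M≡ , ¬b′∼P , b′∼t) =
    subst Shortcut (cong (D ++_) (sym M≡))
      (shortcut D P t E (subst Preferred (cong (D ++_) M≡) pref)
        (subst (λ M → Linked _∼_ (a′ ∷ M)) M≡ (a′∼s ∷ Linked-++⁻ʳ D linked))
        (subst (λ M → All (λ z → ¬ a′ ∼ z) (drop 1 M)) M≡ ¬a′∼S′) b′∼t ¬b′∼P)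

module Asteroid (G : BipartiteGraph) {k : ℕ} (1≤k : 1 ≤ k) {u v : Fin (suc (2 * k)) → Vertex G}
  (v-injective : Injective _≡_ _≡_ v)
  (u∈X : ∀ i → X G (u i)) (v∈Y : ∀ i → Y G (v i)) (u∼v : ∀ i → Adj G (u i) (v i))
  (no-edges-a : ∀ i → NoEdges G (u i ∷ v i ∷ []) (v (i ⊕ k) ∷ v (i ⊕ (k + 1)) ∷ []))
  (no-edges-b : ∀ j → 1 ≤ toℕ j → NoEdges G (u zero ∷ v zero ∷ []) (v j ∷ []))
  where

  Index : Set
  Index = Fin (suc (2 * k))

  -- Admissible G k u v i P unfolds to IsPath G (u i) (u (i ⊕ 1)) P × Compatible i P.
  Compatible : Index → List (Vertex G) → Set
  Compatible i P = (∀ j → j ⊕ k ≡ i → NoEdges G (u j ∷ v j ∷ []) P) ×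
                   (1 ≤ toℕ i → toℕ i < 2 * k → NoEdges G (u zero ∷ v zero ∷ []) P)

  compatible-∈ : ∀ {i P x} → Compatible i P → x ∈ P → Compatible i (x ∷ [])
  compatible-∈ (compatible-a , compatible-b) x∈P =
    (λ { j j⊕k≡i s∈ (here refl) → compatible-a j j⊕k≡i s∈ x∈P }) ,
    (λ { 1≤i i<2k s∈ (here refl) → compatible-b 1≤i i<2k s∈ x∈P })

  compatible-∀∈ : ∀ {i P} → (∀ {x} → x ∈ P → Compatible i (x ∷ [])) → Compatible i P
  compatible-∀∈ compatible =
    (λ j j⊕k≡i s∈ t∈P → proj₁ (compatible t∈P) j j⊕k≡i s∈ (here refl)) ,
    (λ 1≤i i<2k s∈ t∈P → proj₂ (compatible t∈P) 1≤i i<2k s∈ (here refl))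

  1≤2k : 1 ≤ 2 * k
  1≤2k = ≤-trans 1≤k (m≤n*m k 2)

  toℕ-⊕1≥1 : ∀ (i : Index) → toℕ i < 2 * k → 1 ≤ toℕ (i ⊕ 1)
  toℕ-⊕1≥1 i i<2k = subst (1 ≤_) (sym (toℕ-⊕1 i i<2k)) (s≤s z≤n)

  compatible-v : ∀ i → Compatible i (v i ∷ [])
  compatible-v i =
    (λ { j refl s∈ (here refl) → no-edges-a j s∈ (here refl) }) ,
    (λ { 1≤i _ s∈ (here refl) → no-edges-b i 1≤i s∈ (here refl) })

  compatible-v⊕1 : ∀ i → Compatible i (v (i ⊕ 1) ∷ [])
  compatible-v⊕1 i =
    (λ { j refl s∈ (here refl) → no-edges-a j s∈ (there (here (cong v (⊕-assoc j k 1)))) }) ,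
    (λ { _ i<2k s∈ (here refl) → no-edges-b (i ⊕ 1) (toℕ-⊕1≥1 i i<2k) s∈ (here refl) })

  module GoodPaths (i : Index) = ShortestPaths G (λ x → Compatible i (x ∷ [])) (u i) (u (i ⊕ 1))

  module Pref (i : Index) = Preference G (λ x → Compatible i (x ∷ []))
    (u∈X i) (u∈X (i ⊕ 1)) (v∈Y i) (v∈Y (i ⊕ 1)) (u∼v i) (u∼v (i ⊕ 1))
    (⊕1-≢ 1≤2k i ∘ v-injective) (compatible-v i) (compatible-v⊕1 i)

  chosen⇒preferred : ∀ i {W} → Chosen G k u v i W → Pref.Preferred i W
  chosen⇒preferred i ((path , compatible) , minimal) = record
    { shortest   = (path , compatible-∈ compatible) , λ Q → proj₁ (minimal _ (admissible Q))
    ; prefers-a′ = λ Q → proj₁ (proj₂ (minimal _ (admissible Q)))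
    ; prefers-b′ = λ Q → proj₂ (proj₂ (minimal _ (admissible Q)))
    }
    where
    admissible : ∀ {Q} → GoodPaths.GoodPath i Q → Admissible G k u v i Q
    admissible (path , good) = path , compatible-∀∈ good

  InUnion-mono : ∀ {W₁ W₂} → (∀ i → W₁ i ⊆ u i ∷ v i ∷ u (i ⊕ 1) ∷ v (i ⊕ 1) ∷ W₂ i) →
                 ∀ {x} → InUnion G k u v W₁ x → InUnion G k u v W₂ x
  InUnion-mono _ (inj₁ x≡u)        = inj₁ x≡u
  InUnion-mono _ (inj₂ (inj₁ x≡v)) = inj₂ (inj₁ x≡v)
  InUnion-mono W₁⊆ (inj₂ (inj₂ (i , x∈W₁))) with W₁⊆ i x∈W₁
  ... | here x≡                          = inj₁ (i , x≡)
  ... | there (here x≡)                  = inj₂ (inj₁ (i , x≡))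
  ... | there (there (here x≡))          = inj₁ (i ⊕ 1 , x≡)
  ... | there (there (there (here x≡)))  = inj₂ (inj₁ (i ⊕ 1 , x≡))
  ... | there (there (there (there x∈))) = inj₂ (inj₂ (i , x∈))

  module Shortcuts (W : Index → List (Vertex G)) (chosen : ∀ i → Chosen G k u v i (W i)) where

    private
      shortcut : ∀ i → Pref.Shortcut i (W i)
      shortcut i = Pref.preferred⇒shortcut i (chosen⇒preferred i (chosen i))

      compatible : ∀ i → Compatible i (W i)
      compatible i = proj₂ (proj₁ (chosen i))

      u∈W : ∀ i → u i ∈ W i
      u∈W i = head≡just⇒∈ (proj₁ (proj₁ (proj₁ (chosen i))))

      u⊕1∈W : ∀ i → u (i ⊕ 1) ∈ W i
      u⊕1∈W i = last≡just⇒∈ (proj₁ (proj₂ (proj₁ (proj₁ (chosen i)))))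

    W′ : Index → List (Vertex G)
    W′ i = Pref.Shortcut.path (shortcut i)

    W′-induced : ∀ i → IsInducedPath G (v i) (v (i ⊕ 1)) (W′ i)
    W′-induced i = Pref.Shortcut.induced (shortcut i)

    W′⊆ : ∀ i → W′ i ⊆ v i ∷ v (i ⊕ 1) ∷ W i
    W′⊆ i = Pref.Shortcut.path⊆ (shortcut i)

    ⊆W′ : ∀ i → W i ⊆ u i ∷ v i ∷ u (i ⊕ 1) ∷ v (i ⊕ 1) ∷ W′ i
    ⊆W′ i = Pref.Shortcut.⊆path (shortcut i)

    condition-a : ∀ i → NoEdges G (u i ∷ v i ∷ []) (u (i ⊕ k) ∷ u (i ⊕ (k + 1)) ∷ W′ (i ⊕ k))
    condition-a i s∈ (here refl) = proj₁ (compatible (i ⊕ k)) i refl s∈ (u∈W (i ⊕ k))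
    condition-a i s∈ (there (here refl)) =
      proj₁ (compatible (i ⊕ k)) i refl s∈
        (subst (λ j → u j ∈ W (i ⊕ k)) (⊕-assoc i k 1) (u⊕1∈W (i ⊕ k)))
    condition-a i s∈ (there (there x∈W′)) with W′⊆ (i ⊕ k) x∈W′
    ... | here refl          = no-edges-a i s∈ (here refl)
    ... | there (here refl)  = no-edges-a i s∈ (there (here (cong v (⊕-assoc i k 1))))
    ... | there (there x∈W)  = proj₁ (compatible (i ⊕ k)) i refl s∈ x∈W

    condition-b-u : ∀ j → 1 ≤ toℕ j → NoEdges G (u zero ∷ v zero ∷ []) (u j ∷ [])
    condition-b-u j 1≤j s∈ (here refl) with toℕ j <? 2 * k
    ... | yes j<2k = proj₂ (compatible j) 1≤j j<2k s∈ (u∈W j)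
    ... | no  j≮2k with ⊕1-predecessor j 1≤j
    ...   | i , refl , i+1≡j = proj₂ (compatible i) 1≤i (≤-reflexive i+1≡2k) s∈ (u⊕1∈W i)
      where
      i+1≡2k : suc (toℕ i) ≡ 2 * k
      i+1≡2k = trans i+1≡j (≤-antisym (s≤s⁻¹ (toℕ<n (i ⊕ 1))) (≮⇒≥ j≮2k))
      1≤i : 1 ≤ toℕ i
      1≤i = s≤s⁻¹ (subst (2 ≤_) (sym i+1≡2k) (*-monoʳ-≤ 2 1≤k))

    condition-b-W′ : ∀ j → 1 ≤ toℕ j → toℕ j < 2 * k → NoEdges G (u zero ∷ v zero ∷ []) (W′ j)
    condition-b-W′ j 1≤j j<2k s∈ x∈W′ with W′⊆ j x∈W′
    ... | here refl         = no-edges-b j 1≤j s∈ (here refl)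
    ... | there (here refl) = no-edges-b (j ⊕ 1) (toℕ-⊕1≥1 j j<2k) s∈ (here refl)
    ... | there (there x∈W) = proj₂ (compatible j) 1≤j j<2k s∈ x∈W

    same-union : ∀ x → InUnion G k u v W x ⇔ InUnion G k u v W′ x
    same-union x = mk⇔ (InUnion-mono ⊆W′) (InUnion-mono W′⊆ends)
      where
      W′⊆ends : ∀ i → W′ i ⊆ u i ∷ v i ∷ u (i ⊕ 1) ∷ v (i ⊕ 1) ∷ W i
      W′⊆ends i x∈W′ with W′⊆ i x∈W′
      ... | here x≡         = there (here x≡)
      ... | there (here x≡) = there (there (there (here x≡)))
      ... | there (there x∈W) = there (there (there (there x∈W)))

mainTheorem16 : (G : BipartiteGraph) (k : ℕ) → 1 ≤ k →
    (u v : Fin (suc (2 * k)) → Vertex G) →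
    Injective _≡_ _≡_ u → Injective _≡_ _≡_ v →
    SpecialEdgeAsteroid G k u v →
    (W : Fin (suc (2 * k)) → List (Vertex G)) →
    (∀ i → Chosen G k u v i (W i)) →
    Σ (Fin (suc (2 * k)) → List (Vertex G)) λ W′ →
      (∀ i → IsInducedPath G (v i) (v (i ⊕ 1)) (W′ i)) ×
      (∀ i → NoEdges G (u i ∷ v i ∷ [])
                       (u (i ⊕ k) ∷ u (i ⊕ (k + 1)) ∷ W′ (i ⊕ k))) ×
      (∀ j → 1 ≤ toℕ j → NoEdges G (u zero ∷ v zero ∷ []) (u j ∷ [])) ×
      (∀ j → 1 ≤ toℕ j → toℕ j < 2 * k →
             NoEdges G (u zero ∷ v zero ∷ []) (W′ j)) ×
      (∀ x → InUnion G k u v W x ⇔ InUnion G k u v W′ x)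
mainTheorem16 G k 1≤k u v _ v-injective (u∈X , v∈Y , u∼v , _ , _ , no-edges-a , no-edges-b , _) W chosen =
  W′ , W′-induced , condition-a , condition-b-u , condition-b-W′ , same-union
  where
  open Asteroid G 1≤k v-injective u∈X v∈Y u∼v
    (λ i s∈ t∈ → no-edges-a i s∈ (∈-++⁺ˡ t∈)) no-edges-b
  open Shortcuts W chosen
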